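{- Let $t \ge 3$ and $n \ge 3$ be integers with $n \ne 4$. Then $M_t(C_n)$ is not a distance magic graph.
   Context: $C_n$ is the cycle on $n$ vertices. For a graph $G=(V,E)$ and an integer $t \ge 1$, the generalised Mycielskian $M_t(G)$ is the graph with vertex set $(V \times \{0,1,\dots,t-1\}) \cup \{u\}$ (where $u$ is a new vertex), whose edges are: $(x,0)(y,0)$ for every edge $xy \in E$; $(x,i)(y,i+1)$ for every $0 \le i \le t-2$ and every ordered pair $(x,y)$ with $xy \in E$; and $(x,t-1)u$ for every $x \in V$. A graph $H$ on $N$ vertices is distance magic if there is a bijection $f: V(H) \to \{1,2,\dots,N\}$ and a constant $k$ such that for every vertex $v$, $\sum_{w \in N(v)} f(w) = k$, where $N(v)$ is the open neighbourhood of $v$. -}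

module Defs where

open import Data.Nat using (ℕ; zero; suc; _+_; _*_; _∸_; _≡ᵇ_; _%_; NonZero)
open import Data.Fin using (Fin; toℕ; splitAt; remQuot)
open import Data.Bool using (Bool; true; false; _∧_; _∨_; if_then_else_)
open import Data.Sum using (_⊎_; inj₁; inj₂)
open import Data.Product using (Σ; _×_; _,_)
open import Data.List using (map; allFin)
open import Data.Nat.ListAction using (sum)
open import Relation.Binary.PropositionalEquality using (_≡_)
open import Function.Definitions using (Bijective)

-- A finite (simple) graph on the vertex set Fin order, with a Boolean
-- adjacency relation (all graphs built below are symmetric and loopless).
record Graph : Set where
  field
    order : ℕ
    adj   : Fin order → Fin order → Bool
open Graph public

cycleAdj : (n : ℕ) → Fin n → Fin n → Bool
cycleAdj zero    x y = false
cycleAdj (suc m) x y =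
  (toℕ y ≡ᵇ ((toℕ x + 1) % suc m)) ∨ (toℕ x ≡ᵇ ((toℕ y + 1) % suc m))

C : ℕ → Graph
C n = record { order = n ; adj = cycleAdj n }

-- Vertices of M_t(G): Fin (t * N + 1).  A vertex is either (i , x) ∈ Fin t × V
-- (decoded via splitAt and remQuot) or the apex u (the last vertex).
data MVertex (t N : ℕ) : Set where
  layer : Fin t → Fin N → MVertex t N
  apex  : MVertex t N

decode : (t N : ℕ) → Fin (t * N + 1) → MVertex t N
decode t N v with splitAt (t * N) {1} v
... | inj₁ w with remQuot {t} N w
...   | (i , x) = layer i x
decode t N v | inj₂ _ = apex

mycAdj : (t N : ℕ) → (Fin N → Fin N → Bool) → MVertex t N → MVertex t N → Bool
mycAdj t N a (layer i x) (layer j y) =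
  a x y ∧ (((toℕ i ≡ᵇ 0) ∧ (toℕ j ≡ᵇ 0))
           ∨ (toℕ j ≡ᵇ suc (toℕ i))
           ∨ (toℕ i ≡ᵇ suc (toℕ j)))
mycAdj t N a (layer i x) apex = toℕ i ≡ᵇ (t ∸ 1)
mycAdj t N a apex (layer j y) = toℕ j ≡ᵇ (t ∸ 1)
mycAdj t N a apex apex = false

Mycielskian : ℕ → Graph → Graph
Mycielskian t G = record
  { order = t * order G + 1
  ; adj   = λ v w → mycAdj t (order G) (adj G) (decode t (order G) v) (decode t (order G) w)
  }

nbrSum : (G : Graph) → (Fin (order G) → ℕ) → Fin (order G) → ℕ
nbrSum G ℓ v = sum (map (λ w → if adj G v w then ℓ w else 0) (allFin (order G)))

-- G is distance magic: a bijection f : V → {1,…,N} (encoded as Fin N, label = toℕ (f w) + 1)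
-- and a constant k with every open-neighbourhood label sum equal to k.
DistanceMagic : Graph → Set
DistanceMagic G =
  Σ (Fin (order G) → Fin (order G)) λ f →
    Bijective _≡_ _≡_ f ×
    Σ ℕ λ k → ∀ v → nbrSum G (λ w → suc (toℕ (f w))) v ≡ k

{-# OPTIONS --safe #-}
-- If N(u) ∖ N(v) = {a} and N(v) ∖ N(u) = {d}, the magic equations at u and v give f(a) = f(d),
-- contradicting injectivity of the labelling. In M_t(C_n) take the top-layer copies of two cycle
-- vertices sharing exactly one neighbour (0 and 1 for n = 3, 1 and 3 for n ≥ 5): their common
-- neighbours are the apex and the copy of the shared vertex, and the two private neighbours
-- lie in the layer below.
module Submission where

open import Defs
open import Data.Nat using (ℕ; zero; suc; _+_; _*_; _≡ᵇ_; _<_; _≤_; s≤s; z≤n; _%_)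
open import Data.Nat.Properties as ℕ using (≡ᵇ⇒≡; ≡⇒≡ᵇ; <-irrefl; +-comm; +-assoc; +-cancelˡ-≡; m≤n⇒m<n∨m≡n)
open import Data.Nat.DivMod using (n%n≡0; m<n⇒m%n≡m)
open import Data.Fin using (Fin; zero; suc; toℕ; fromℕ; inject₁; splitAt; combine; _↑ˡ_; _↑ʳ_; join; #_)
open import Data.Fin.Properties using (_≟_; suc-injective; splitAt-↑ˡ; remQuot-combine; combine-remQuot; join-splitAt; toℕ-injective; toℕ-fromℕ; toℕ-inject₁; toℕ<n)
open import Data.Bool using (Bool; true; false; _∧_; _∨_; if_then_else_; T)
open import Data.Bool.Properties using (∨-idem; ∧-zeroʳ; T-∨; T-≡; ⇔→≡)
open import Data.Unit using (tt)
open import Data.Sum using (_⊎_; inj₁; inj₂; [_,_]′; map₂)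
open import Data.Product using (_,_; uncurry)
open import Data.List using (tabulate)
open import Data.List.Properties using (tabulate-cong; map-tabulate)
open import Data.Nat.ListAction using (sum)
open import Function using (_∘_)
open import Function.Bundles using (Equivalence; mk⇔)
open import Relation.Nullary using (¬_; yes; no; contradiction)
open import Relation.Binary.PropositionalEquality using (_≡_; _≢_; refl; sym; trans; cong; cong₂; subst; module ≡-Reasoning)

open Equivalence using (to; from)

¬T⇒≡false : ∀ {b} → ¬ T b → b ≡ false
¬T⇒≡false {false} _ = refl
¬T⇒≡false {true}  ¬T = contradiction tt ¬T

selectSum : ∀ {N} → (Fin N → Bool) → (Fin N → ℕ) → ℕ
selectSum p ℓ = sum (tabulate (λ w → if p w then ℓ w else 0))

selectSum-cong : ∀ {N} {p q : Fin N → Bool} (ℓ : Fin N → ℕ) →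
                 (∀ w → p w ≡ q w) → selectSum p ℓ ≡ selectSum q ℓ
selectSum-cong ℓ p≗q =
  cong sum (tabulate-cong (λ w → cong (λ b → if b then ℓ w else 0) (p≗q w)))

selectSum-insert : ∀ {N} (p q : Fin N → Bool) (ℓ : Fin N → ℕ) d →
                   p d ≡ false → q d ≡ true → (∀ w → w ≢ d → p w ≡ q w) →
                   selectSum q ℓ ≡ selectSum p ℓ + ℓ d
selectSum-insert {suc N} p q ℓ zero pd qd agree rewrite pd | qd =
  trans (cong (ℓ zero +_) (selectSum-cong (ℓ ∘ suc) (λ w → sym (agree (suc w) λ ()))))
        (+-comm (ℓ zero) _)
selectSum-insert {suc N} p q ℓ (suc d) pd qd agree =
  trans (cong₂ _+_ (cong (λ b → if b then ℓ zero else 0) (sym (agree zero λ ())))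
                   (selectSum-insert (p ∘ suc) (q ∘ suc) (ℓ ∘ suc) d pd qd
                                     (λ w w≢d → agree (suc w) (w≢d ∘ suc-injective))))
        (sym (+-assoc (if p zero then ℓ zero else 0) _ (ℓ (suc d))))

-- Both sums are compared with the sum over the union p ∨ q.
selectSum-exchange : ∀ {N} (p q : Fin N → Bool) (ℓ : Fin N → ℕ) {a d} →
                     p a ≡ true → p d ≡ false → q a ≡ false → q d ≡ true →
                     (∀ w → w ≢ a → w ≢ d → p w ≡ q w) →
                     selectSum p ℓ + ℓ d ≡ selectSum q ℓ + ℓ a
selectSum-exchange p q ℓ {a} {d} pa pd qa qd agree =
  trans (sym (selectSum-insert p p∨q ℓ d pd (trans (cong (_∨ q d) pd) qd) p≗p∨q))
        (selectSum-insert q p∨q ℓ a qa (cong (_∨ q a) pa) q≗p∨q)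
  where
  p∨q : Fin _ → Bool
  p∨q w = p w ∨ q w
  p≗p∨q : ∀ w → w ≢ d → p w ≡ p∨q w
  p≗p∨q w w≢d with w ≟ a
  ... | yes refl rewrite pa = refl
  ... | no w≢a rewrite agree w w≢a w≢d = sym (∨-idem (q w))
  q≗p∨q : ∀ w → w ≢ a → q w ≡ p∨q w
  q≗p∨q w w≢a with w ≟ d
  ... | yes refl rewrite pd = refl
  ... | no w≢d rewrite agree w w≢a w≢d = sym (∨-idem (q w))

nbrSum≡selectSum : (G : Graph) (ℓ : Fin (order G) → ℕ) (v : Fin (order G)) →
                   nbrSum G ℓ v ≡ selectSum (adj G v) ℓ
nbrSum≡selectSum G ℓ v = cong sum (map-tabulate (λ w → w) (λ w → if adj G v w then ℓ w else 0))

record NeighbourSwap (G : Graph) : Set where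
  field
    u v a d : Fin (order G)
    a≢d     : a ≢ d
    u∼a     : adj G u a ≡ true
    u≁d     : adj G u d ≡ false
    v≁a     : adj G v a ≡ false
    v∼d     : adj G v d ≡ true
    agree   : ∀ w → w ≢ a → w ≢ d → adj G u w ≡ adj G v w

module _ {G : Graph} (swap : NeighbourSwap G) where
  open NeighbourSwap swap

  nbrSum-swap : ∀ ℓ → nbrSum G ℓ u + ℓ d ≡ nbrSum G ℓ v + ℓ a
  nbrSum-swap ℓ = begin
    nbrSum G ℓ u + ℓ d              ≡⟨ cong (_+ ℓ d) (nbrSum≡selectSum G ℓ u) ⟩
    selectSum (adj G u) ℓ + ℓ d     ≡⟨ selectSum-exchange (adj G u) (adj G v) ℓ u∼a u≁d v≁a v∼d agree ⟩
    selectSum (adj G v) ℓ + ℓ a     ≡⟨ cong (_+ ℓ a) (nbrSum≡selectSum G ℓ v) ⟨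
    nbrSum G ℓ v + ℓ a              ∎
    where open ≡-Reasoning

  NeighbourSwap⇒¬DistanceMagic : ¬ DistanceMagic G
  NeighbourSwap⇒¬DistanceMagic (f , (f-injective , _) , k , magic) =
    a≢d (sym (f-injective (toℕ-injective (ℕ.suc-injective ℓd≡ℓa))))
    where
    ℓ : Fin (order G) → ℕ
    ℓ w = suc (toℕ (f w))
    ℓd≡ℓa : ℓ d ≡ ℓ a
    ℓd≡ℓa = +-cancelˡ-≡ k (ℓ d) (ℓ a) (begin
      k + ℓ d              ≡⟨ cong (_+ ℓ d) (magic u) ⟨
      nbrSum G ℓ u + ℓ d   ≡⟨ nbrSum-swap ℓ ⟩
      nbrSum G ℓ v + ℓ a   ≡⟨ cong (_+ ℓ a) (magic v) ⟩
      k + ℓ a              ∎)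
      where open ≡-Reasoning

encode : ∀ {t N} → MVertex t N → Fin (t * N + 1)
encode (layer i x) = combine i x ↑ˡ 1
encode {t} {N} apex = (t * N) ↑ʳ zero

decode-encode : ∀ {t N} (i : Fin t) (x : Fin N) → decode t N (encode (layer i x)) ≡ layer i x
decode-encode {t} {N} i x rewrite splitAt-↑ˡ (t * N) (combine i x) 1 =
  cong (uncurry layer) (remQuot-combine {t} {N} i x)

encode-decode : ∀ {t N} (w : Fin (t * N + 1)) → encode (decode t N w) ≡ w
encode-decode {t} {N} w with splitAt (t * N) {1} w in eq
... | inj₁ k = trans (cong (_↑ˡ 1) (combine-remQuot {t} N k))
                     (trans (cong (join (t * N) 1) (sym eq)) (join-splitAt (t * N) 1 w))
... | inj₂ zero = trans (cong (join (t * N) 1) (sym eq)) (join-splitAt (t * N) 1 w)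

layer-injective : ∀ {t N} {i j : Fin t} {x y : Fin N} → layer i x ≡ layer j y → x ≡ y
layer-injective refl = refl

-- mycAdj t N a (layer i x) (layer j y) is definitionally a x y ∧ layerLink i j.
layerLink : ∀ {t} → Fin t → Fin t → Bool
layerLink i j = ((toℕ i ≡ᵇ 0) ∧ (toℕ j ≡ᵇ 0)) ∨ (toℕ j ≡ᵇ suc (toℕ i)) ∨ (toℕ i ≡ᵇ suc (toℕ j))

module _ (s : ℕ) where
  top below : Fin (suc (suc s))
  top   = fromℕ (suc s)
  below = inject₁ (fromℕ s)

  toℕ-below : toℕ below ≡ s
  toℕ-below = trans (toℕ-inject₁ (fromℕ s)) (toℕ-fromℕ s)

  layerLink-top-below : layerLink top below ≡ true
  layerLink-top-below =
    to T-≡ (from T-∨ (inj₂ (≡⇒≡ᵇ (toℕ (fromℕ s)) (toℕ below) (trans (toℕ-fromℕ s) (sym toℕ-below)))))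

  -- Since top ≠ 0 and there is no layer above top, top is linked to the layer below only.
  layerLink-top⇒below : ∀ j → T (layerLink top j) → j ≡ below
  layerLink-top⇒below j link with to T-∨ link
  ... | inj₁ j≡top+1 =
    contradiction (toℕ<n j)
      (<-irrefl (trans (≡ᵇ⇒≡ (toℕ j) _ j≡top+1) (cong (λ n → suc (suc n)) (toℕ-fromℕ s))))
  ... | inj₂ top≡j+1 =
    toℕ-injective (trans (sym (≡ᵇ⇒≡ _ (toℕ j) top≡j+1)) (trans (toℕ-fromℕ s) (sym toℕ-below)))

  -- A top-layer vertex is adjacent exactly to the apex and to the copies of its G-neighbours
  -- in the layer below.
  Mycielskian-swap : ∀ {G} → NeighbourSwap G → NeighbourSwap (Mycielskian (suc (suc s)) G)
  Mycielskian-swap {G} swap = record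
    { u     = encode (layer top u)
    ; v     = encode (layer top v)
    ; a     = encode (layer below a)
    ; d     = encode (layer below d)
    ; a≢d   = λ e → a≢d (layer-injective (trans (sym (decode-encode below a))
                                          (trans (cong (decode t N) e) (decode-encode below d))))
    ; u∼a   = trans (adj-layers u a) (cong₂ _∧_ u∼a layerLink-top-below)
    ; u≁d   = trans (adj-layers u d) (cong (_∧ layerLink top below) u≁d)
    ; v≁a   = trans (adj-layers v a) (cong (_∧ layerLink top below) v≁a)
    ; v∼d   = trans (adj-layers v d) (cong₂ _∧_ v∼d layerLink-top-below)
    ; agree = λ w w≢a w≢d →
        trans (cong (λ m → mycAdj t N (adj G) m (decode t N w)) (decode-encode top u))
        (trans (agree-top (decode t N w) (w≢a ∘ decoded-below w) (w≢d ∘ decoded-below w))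
               (cong (λ m → mycAdj t N (adj G) m (decode t N w)) (sym (decode-encode top v))))
    }
    where
    open NeighbourSwap swap
    t N : ℕ
    t = suc (suc s)
    N = order G

    adj-layers : ∀ x y → adj (Mycielskian t G) (encode (layer top x)) (encode (layer below y))
                         ≡ adj G x y ∧ layerLink top below
    adj-layers x y = cong₂ (mycAdj t N (adj G)) (decode-encode top x) (decode-encode below y)

    decoded-below : ∀ w {y} → decode t N w ≡ layer below y → w ≡ encode (layer below y)
    decoded-below w e = trans (sym (encode-decode {t} {N} w)) (cong encode e)

    agree-top : ∀ m → m ≢ layer below a → m ≢ layer below d →
                mycAdj t N (adj G) (layer top u) m ≡ mycAdj t N (adj G) (layer top v) m
    agree-top apex _ _ = refl
    agree-top (layer j y) m≢a m≢d with layerLink top j in link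
    ... | false = trans (∧-zeroʳ (adj G u y)) (sym (∧-zeroʳ (adj G v y)))
    ... | true with layerLink-top⇒below j (from T-≡ link)
    ...   | refl = cong (_∧ true) (agree y (λ { refl → m≢a refl }) (λ { refl → m≢d refl }))

cycleAdj-inner : ∀ {k} (x y : Fin (suc k)) → 0 < toℕ x → suc (toℕ x) < suc k →
                 T (cycleAdj (suc k) x y) → toℕ y ≡ suc (toℕ x) ⊎ suc (toℕ y) ≡ toℕ x
cycleAdj-inner {k} x y 0<x x+1<n adj with to T-∨ adj
... | inj₁ y≡x+1 = inj₁ (begin
  toℕ y                  ≡⟨ ≡ᵇ⇒≡ _ _ y≡x+1 ⟩
  (toℕ x + 1) % suc k    ≡⟨ cong (_% suc k) (+-comm (toℕ x) 1) ⟩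
  suc (toℕ x) % suc k    ≡⟨ m<n⇒m%n≡m x+1<n ⟩
  suc (toℕ x)            ∎)
  where open ≡-Reasoning
... | inj₂ x≡y+1 with m≤n⇒m<n∨m≡n (toℕ<n y)
...   | inj₁ y+1<n = inj₂ (sym (begin
  toℕ x                  ≡⟨ ≡ᵇ⇒≡ _ _ x≡y+1 ⟩
  (toℕ y + 1) % suc k    ≡⟨ cong (_% suc k) (+-comm (toℕ y) 1) ⟩
  suc (toℕ y) % suc k    ≡⟨ m<n⇒m%n≡m y+1<n ⟩
  suc (toℕ y)            ∎))
  where open ≡-Reasoning
...   | inj₂ y+1≡n = contradiction 0<x (<-irrefl (sym (begin
  toℕ x                  ≡⟨ ≡ᵇ⇒≡ _ _ x≡y+1 ⟩
  (toℕ y + 1) % suc k    ≡⟨ cong (_% suc k) (trans (+-comm (toℕ y) 1) y+1≡n) ⟩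
  suc k % suc k          ≡⟨ n%n≡0 (suc k) ⟩
  0                      ∎)))
  where open ≡-Reasoning

cycle3-swap : NeighbourSwap (C 3)
cycle3-swap = record
  { u = # 0 ; v = # 1 ; a = # 1 ; d = # 0
  ; a≢d = λ () ; u∼a = refl ; u≁d = refl ; v≁a = refl ; v∼d = refl
  ; agree = λ { zero _ w≢d → contradiction refl w≢d
              ; (suc zero) w≢a _ → contradiction refl w≢a
              ; (suc (suc zero)) _ _ → refl }
  }

-- For n ≥ 5 the vertices 1 and 3 have the single common neighbour 2.
cycle≥5-swap : ∀ m → NeighbourSwap (C (5 + m))
cycle≥5-swap m = record
  { u = # 1 ; v = # 3 ; a = # 0 ; d = # 4
  ; a≢d = λ ()
  ; u∼a = refl
  ; u≁d = ¬T⇒≡false λ adj → [ (λ ()) , (λ ()) ]′ (nbrs₁ (# 4) adj)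
  ; v≁a = ¬T⇒≡false λ adj → [ (λ ()) , (λ ()) ]′ (nbrs₃ (# 0) adj)
  ; v∼d = refl
  ; agree = λ w w≢0 w≢4 → ⇔→≡ (mk⇔
      (λ adj → subst (λ y → cycleAdj n (# 3) y ≡ true) (sym (only-two₁ w w≢0 adj)) refl)
      (λ adj → subst (λ y → cycleAdj n (# 1) y ≡ true) (sym (only-two₃ w w≢4 adj)) refl))
  }
  where
  n : ℕ
  n = 5 + m

  nbrs₁ : ∀ y → T (cycleAdj n (# 1) y) → toℕ y ≡ 2 ⊎ toℕ y ≡ 0
  nbrs₁ y adj = map₂ ℕ.suc-injective (cycleAdj-inner (# 1) y (s≤s z≤n) (s≤s (s≤s (s≤s z≤n))) adj)

  nbrs₃ : ∀ y → T (cycleAdj n (# 3) y) → toℕ y ≡ 4 ⊎ toℕ y ≡ 2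
  nbrs₃ y adj =
    map₂ ℕ.suc-injective (cycleAdj-inner (# 3) y (s≤s z≤n) (s≤s (s≤s (s≤s (s≤s (s≤s z≤n))))) adj)

  only-two₁ : ∀ w → w ≢ # 0 → cycleAdj n (# 1) w ≡ true → w ≡ # 2
  only-two₁ w w≢0 adj =
    [ toℕ-injective , (λ w≡0 → contradiction (toℕ-injective w≡0) w≢0) ]′ (nbrs₁ w (from T-≡ adj))

  only-two₃ : ∀ w → w ≢ # 4 → cycleAdj n (# 3) w ≡ true → w ≡ # 2
  only-two₃ w w≢4 adj =
    [ (λ w≡4 → contradiction (toℕ-injective w≡4) w≢4) , toℕ-injective ]′ (nbrs₃ w (from T-≡ adj))

cycle-swap : ∀ {n} → 3 ≤ n → n ≢ 4 → NeighbourSwap (C n)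
cycle-swap {suc (suc zero)}                (s≤s (s≤s ())) _
cycle-swap {suc (suc (suc zero))}          _ _   = cycle3-swap
cycle-swap {suc (suc (suc (suc zero)))}    _ n≢4 = contradiction refl n≢4
cycle-swap {suc (suc (suc (suc (suc m))))} _ _   = cycle≥5-swap m

corollary2p7 : (t n : ℕ) → 3 ≤ t → 3 ≤ n → n ≢ 4 → ¬ DistanceMagic (Mycielskian t (C n))
corollary2p7 (suc zero)    n (s≤s ()) _ _
corollary2p7 (suc (suc s)) n _ 3≤n n≢4 =
  NeighbourSwap⇒¬DistanceMagic (Mycielskian-swap s (cycle-swap 3≤n n≢4))
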